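{- Let $k_1=1$ and $k_n = \lfloor n/2\rfloor + k_{\lfloor n/2\rfloor} + k_{\lfloor (n+1)/2\rfloor}$ for $n\ge 2$. Then $I(n) \geq k_{n-1}+1$ for every $n>1$. Moreover, $k_n > \frac{1}{2}(n\log_2 n - n + 1)$ for every $n\in\mathbb{N}$, and thus $$I(n) > \tfrac{1}{2}(n-1)\log_2(n-1) - \tfrac{1}{2}n + 2$$ for every $n>1$.
   Context: An ideal on a set $X$ is a family of subsets of $X$ containing all finite subsets, closed under finite unions and subsets; proper if $X$ is not a member. Proper ideals $\mathcal{I},\mathcal{J}$ on $X$ are incompatible if some $A\in\mathcal{I}$ has $X\setminus A\in\mathcal{J}$; $B\subseteq X$ chooses between them if $B\in\mathcal{I}\setminus\mathcal{J}$ or $B\in\mathcal{J}\setminus\mathcal{I}$. $I(n)$ is the least $k$ such that for any set $X$ and any $k$ pairs of incompatible ideals on $X$, some $A\subseteq X$ chooses between at least $n$ of the pairs. -}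

module Defs where

open import Data.Bool using (Bool; true; false; _∨_; not)
open import Data.Nat using (ℕ)
open import Data.Fin using (Fin)
open import Data.List using (List)
open import Data.List.Membership.Propositional using (_∈_)
open import Data.Product using (Σ; _×_)
open import Data.Sum using (_⊎_)
open import Function.Definitions using (Injective)
open import Relation.Binary.PropositionalEquality using (_≡_)
open import Relation.Nullary using (¬_)

Subset : Set → Set
Subset X = X → Bool

record Ideal (X : Set) : Set₁ where
  field
    mem    : Subset X → Set
    finite : (xs : List X) (A : Subset X) → (∀ x → A x ≡ true → x ∈ xs) → mem A
    union  : (A B : Subset X) → mem A → mem B → mem (λ x → A x ∨ B x)
    down   : (A B : Subset X) → (∀ x → B x ≡ true → A x ≡ true) → mem A → mem B
open Ideal public

Proper : {X : Set} → Ideal X → Set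
Proper I = ¬ mem I (λ _ → true)

record ProperPair (X : Set) : Set₁ where
  field
    fst      : Ideal X
    snd      : Ideal X
    fstProper : Proper fst
    sndProper : Proper snd
open ProperPair public

Incompatible : {X : Set} → ProperPair X → Set
Incompatible {X} p = Σ (Subset X) λ A → mem (fst p) A × mem (snd p) (λ x → not (A x))

Chooses : {X : Set} → Subset X → ProperPair X → Set
Chooses B p = (mem (fst p) B × ¬ mem (snd p) B) ⊎ (mem (snd p) B × ¬ mem (fst p) B)

-- I(n) is the least k with ChoiceProperty n k.
ChoiceProperty : ℕ → ℕ → Set₁
ChoiceProperty n k =
  (X : Set) (pairs : Fin k → ProperPair X) → (∀ i → Incompatible (pairs i)) →
  Σ (Subset X) λ A → Σ (Fin n → Fin k) λ f → Injective _≡_ _≡_ f × (∀ j → Chooses A (pairs (f j)))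

{-# OPTIONS --safe #-}
-- For a finite set P let X = ℕ × P and, for S ⊆ P, let I_S be the ideal of those A ⊆ X
-- whose columns {x | (x , q) ∈ A} are finite for every q ∈ S. Disjoint nonempty S, S′
-- give an incompatible pair (I_S, I_S′), and A chooses between them exactly when the
-- set T of infinite columns of A meets exactly one of S and S′. Take for P two points
-- per leaf of the binary tree obtained by halving N repeatedly, and as pairs, at every
-- node splitting N into ⌊N/2⌋ + ⌈N/2⌉, ⌊N/2⌋ copies of (left points, right points)
-- together with the pairs of both subtrees. These are k_N pairs, and by induction no T
-- splits more than N of them: if T meets both subtrees it splits no copy, and if it
-- meets only one, the other subtree contributes nothing. So k_(n-1) pairs, and hence
-- any fewer, do not suffice for n. The bound on k_N is an induction along the same recursion whose odd
-- step is (2a+1)^(2a+1) ≤ (2a)^a (2a+2)^(a+1), a consequence of Bernoulli's inequality.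
module Submission where

open import Defs
open import Data.Bool using (Bool; true; false; _∨_; _∧_; not; _xor_; if_then_else_)
open import Data.Bool.Properties using (∨-identityʳ; ∨-zeroʳ; ∧-conicalˡ; ∧-conicalʳ)
open import Data.Empty using (⊥-elim)
open import Data.Fin using (Fin; zero; suc; punchOut; inject≤)
open import Data.Fin.Properties using (punchOut-injective; inject≤-injective; suc-injective)
open import Data.List using (List; map)
open import Data.List.Membership.Propositional using (_∈_)
open import Data.List.Membership.Propositional.Properties using (∈-map⁺)
open import Data.List.Relation.Unary.Any using (here; there)
open import Data.Nat
  using (ℕ; zero; suc; _+_; _*_; _∸_; _^_; _≤_; _<_; _⊔_; _/_; ⌊_/2⌋; ⌈_/2⌉; z≤n; s≤s; s≤s⁻¹)
open import Data.Nat.DivMod using (m/n≡1+[m∸n]/n)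
open import Data.Nat.Induction using (<-rec)
open import Data.Nat.ListAction using (sum)
open import Data.Nat.Properties hiding (suc-injective)
open import Data.Nat.Tactic.RingSolver using (solve-∀)
open import Data.Product using (Σ; ∃; _×_; _,_; proj₁; proj₂)
open import Data.Sum using (_⊎_; inj₁; inj₂; [_,_]; [_,_]′)
open import Data.Vec using (Vec; []; _∷_; _++_; lookup; replicate; removeAt; countᵇ)
import Data.Vec as Vec
open import Data.Vec.Properties using (removeAt-punchOut; count≤n)
open import Function using (_∘_; const; id)
open import Function.Definitions using (Injective)
open import Relation.Binary.PropositionalEquality
  using (_≡_; _≢_; refl; sym; trans; cong; cong₂; subst; subst₂; module ≡-Reasoning)
open import Relation.Nullary using (¬_; Dec; yes; no; contradiction)
open import Relation.Nullary.Decidable using (¬¬-excluded-middle; isNo; T?)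

^-distribʳ-* : ∀ m n o → (m * n) ^ o ≡ m ^ o * n ^ o
^-distribʳ-* m n zero    = refl
^-distribʳ-* m n (suc o) = begin
  m * n * (m * n) ^ o        ≡⟨ cong (m * n *_) (^-distribʳ-* m n o) ⟩
  m * n * (m ^ o * n ^ o)    ≡⟨ interchange m n (m ^ o) (n ^ o) ⟩
  m * m ^ o * (n * n ^ o)    ∎
  where
  open ≡-Reasoning
  interchange : ∀ a b c d → a * b * (c * d) ≡ a * c * (b * d)
  interchange = solve-∀

bernoulli : ∀ z c → suc z ^ suc c ≤ z ^ suc c + suc c * suc z ^ c
bernoulli z zero    = ≤-reflexive (+-comm 1 (z * 1))
bernoulli z (suc c) = begin
  suc z * suc z ^ suc c                            ≤⟨ *-monoʳ-≤ (suc z) (bernoulli z c) ⟩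
  suc z * (z ^ suc c + suc c * suc z ^ c)          ≡⟨ expand z c (z ^ suc c) (suc z ^ c) ⟩
  z * z ^ suc c + (z ^ suc c + suc c * suc z ^ suc c)
    ≤⟨ +-monoʳ-≤ (z * z ^ suc c) (+-monoˡ-≤ _ (^-monoˡ-≤ (suc c) (n≤1+n z))) ⟩
  z ^ suc (suc c) + suc (suc c) * suc z ^ suc c    ∎
  where
  open ≤-Reasoning
  expand : ∀ z c p q → suc z * (p + suc c * q) ≡ z * p + (p + suc c * (suc z * q))
  expand = solve-∀

-- The real inequality (1 + 1/z)^a ≤ 1 + 1/x, cleared of denominators. With w = z + 1 − a,
-- Bernoulli's inequality gives w (z + 1)^(a − 1) ≤ z^a.
power-ratio-≤ : ∀ x z a → suc x * a ≤ suc z → x * suc z ^ a ≤ suc x * z ^ a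
power-ratio-≤ x z zero      _ = *-monoˡ-≤ 1 (n≤1+n x)
power-ratio-≤ x z a@(suc c) [1+x]a≤1+z = begin
  x * (suc z * B)          ≡⟨ cong (λ y → x * (y * B)) (sym w+a≡1+z) ⟩
  x * ((w + a) * B)        ≡⟨ *-assoc x (w + a) B ⟨
  x * (w + a) * B          ≤⟨ *-monoˡ-≤ B x[w+a]≤[1+x]w ⟩
  suc x * w * B            ≡⟨ *-assoc (suc x) w B ⟩
  suc x * (w * B)          ≤⟨ *-monoʳ-≤ (suc x) w*B≤z^a ⟩
  suc x * z ^ a            ∎
  where
  open ≤-Reasoning
  B = suc z ^ c
  d = proj₁ (m≤n⇒∃[o]m+o≡n [1+x]a≤1+z)
  w = x * a + d
  w+a≡1+z : w + a ≡ suc z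
  w+a≡1+z = trans (shuffle x a d) (proj₂ (m≤n⇒∃[o]m+o≡n [1+x]a≤1+z))
    where
    shuffle : ∀ x a d → x * a + d + a ≡ suc x * a + d
    shuffle = solve-∀
  x[w+a]≤[1+x]w : x * (w + a) ≤ suc x * w
  x[w+a]≤[1+x]w = begin
    x * (w + a)    ≡⟨ *-distribˡ-+ x w a ⟩
    x * w + x * a  ≤⟨ +-monoʳ-≤ (x * w) (m≤m+n (x * a) d) ⟩
    x * w + w      ≡⟨ +-comm (x * w) w ⟩
    suc x * w      ∎
  w*B≤z^a : w * B ≤ z ^ a
  w*B≤z^a = +-cancelʳ-≤ (a * B) (w * B) (z ^ a) (begin
    w * B + a * B  ≡⟨ *-distribʳ-+ B w a ⟨
    (w + a) * B    ≡⟨ cong (_* B) w+a≡1+z ⟩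
    suc z ^ a      ≤⟨ bernoulli z c ⟩
    z ^ a + a * B  ∎)

odd-power-≤ : ∀ a → suc (2 * a) ^ suc (2 * a) ≤ (2 * a) ^ a * (2 * suc a) ^ suc a
odd-power-≤ a = begin
  x * x ^ (2 * a)                          ≡⟨ cong (x *_) (^-*-assoc x 2 a) ⟨
  x * (x ^ 2) ^ a                          ≡⟨ cong (λ y → x * y ^ a) (square a) ⟩
  x * suc z ^ a                            ≤⟨ power-ratio-≤ x z a [1+x]a≤1+z ⟩
  suc x * z ^ a                            ≡⟨ cong (suc x *_) (^-distribʳ-* (2 * a) (2 * suc a) a) ⟩
  suc x * ((2 * a) ^ a * (2 * suc a) ^ a)  ≡⟨ regroup a ((2 * a) ^ a) ((2 * suc a) ^ a) ⟩
  (2 * a) ^ a * (2 * suc a) ^ suc a        ∎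
  where
  open ≤-Reasoning
  x = suc (2 * a)
  z = 2 * a * (2 * suc a)
  square : ∀ a → suc (2 * a) * (suc (2 * a) * 1) ≡ suc (2 * a * (2 * suc a))
  square = solve-∀
  regroup : ∀ a p q → suc (suc (2 * a)) * (p * q) ≡ p * (2 * suc a * q)
  regroup = solve-∀
  [1+x]a≤1+z : suc x * a ≤ suc z
  [1+x]a≤1+z = subst (suc x * a ≤_) (gap a) (m≤m+n (suc x * a) _)
    where
    gap : ∀ a → suc (suc (2 * a)) * a + suc (2 * (a * a) + 2 * a) ≡ suc (2 * a * (2 * suc a))
    gap = solve-∀

balanced-power-≤ : ∀ {a b} → a ≤ b → b ≤ suc a → (a + b) ^ (a + b) ≤ (2 * a) ^ a * (2 * b) ^ b
balanced-power-≤ {a} {b} a≤b b≤1+a with m≤n⇒m<n∨m≡n b≤1+a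
... | inj₁ b<1+a rewrite ≤-antisym (s≤s⁻¹ b<1+a) a≤b = ≤-reflexive (begin
  (a + a) ^ (a + a)          ≡⟨ ^-distribˡ-+-* (a + a) a a ⟩
  (a + a) ^ a * (a + a) ^ a  ≡⟨ cong (λ m → m ^ a * m ^ a) (double a) ⟩
  (2 * a) ^ a * (2 * a) ^ a  ∎)
  where
  open ≡-Reasoning
  double : ∀ a → a + a ≡ 2 * a
  double = solve-∀
... | inj₂ refl = subst (λ m → m ^ m ≤ (2 * a) ^ a * (2 * suc a) ^ suc a) (sym (a+[1+a] a)) (odd-power-≤ a)
  where
  a+[1+a] : ∀ a → a + suc a ≡ suc (2 * a)
  a+[1+a] = solve-∀

power-bound-step : ∀ {a b ka kb} → a ≤ b → b ≤ suc a →
  2 * a ^ a < 2 ^ (2 * ka + a) → 2 * b ^ b < 2 ^ (2 * kb + b) →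
  2 * (a + b) ^ (a + b) < 2 ^ (2 * (a + ka + kb) + (a + b))
power-bound-step {a} {b} {ka} {kb} a≤b b≤1+a ha hb = begin-strict
  2 * (a + b) ^ (a + b)                     ≤⟨ *-monoʳ-≤ 2 (balanced-power-≤ a≤b b≤1+a) ⟩
  2 * ((2 * a) ^ a * (2 * b) ^ b)
    ≡⟨ cong₂ (λ u v → 2 * (u * v)) (^-distribʳ-* 2 a a) (^-distribʳ-* 2 b b) ⟩
  2 * (2 ^ a * a ^ a * (2 ^ b * b ^ b))     ≡⟨ regroup (2 ^ a) (2 ^ b) (a ^ a) (b ^ b) ⟩
  2 ^ a * 2 ^ b * (2 * (a ^ a * b ^ b))     ≡⟨ cong (_* (2 * (a ^ a * b ^ b))) (^-distribˡ-+-* 2 a b) ⟨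
  2 ^ (a + b) * (2 * (a ^ a * b ^ b))
    ≤⟨ *-monoˡ-≤ (2 * (a ^ a * b ^ b)) (^-monoʳ-≤ 2 (+-monoʳ-≤ a b≤1+a)) ⟩
  2 ^ (a + suc a) * (2 * (a ^ a * b ^ b))   ≡⟨ cong (λ e → 2 ^ e * (2 * (a ^ a * b ^ b))) (+-suc a a) ⟩
  2 * 2 ^ (a + a) * (2 * (a ^ a * b ^ b))   ≡⟨ split (2 ^ (a + a)) (a ^ a) (b ^ b) ⟩
  2 ^ (a + a) * (2 * a ^ a * (2 * b ^ b))   <⟨ *-monoʳ-< (2 ^ (a + a)) {{m^n≢0 2 (a + a)}} (*-mono-< ha hb) ⟩
  2 ^ (a + a) * (2 ^ (2 * ka + a) * 2 ^ (2 * kb + b))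
    ≡⟨ cong (2 ^ (a + a) *_) (^-distribˡ-+-* 2 (2 * ka + a) (2 * kb + b)) ⟨
  2 ^ (a + a) * 2 ^ (2 * ka + a + (2 * kb + b))
    ≡⟨ ^-distribˡ-+-* 2 (a + a) _ ⟨
  2 ^ (a + a + (2 * ka + a + (2 * kb + b))) ≡⟨ cong (2 ^_) (exponent a b ka kb) ⟩
  2 ^ (2 * (a + ka + kb) + (a + b))         ∎
  where
  open ≤-Reasoning
  regroup : ∀ p q r s → 2 * (p * r * (q * s)) ≡ p * q * (2 * (r * s))
  regroup = solve-∀
  split : ∀ p r s → 2 * p * (2 * (r * s)) ≡ p * (2 * r * (2 * s))
  split = solve-∀
  exponent : ∀ a b ka kb → a + a + (2 * ka + a + (2 * kb + b)) ≡ 2 * (a + ka + kb) + (a + b)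
  exponent = solve-∀

n/2≡⌊n/2⌋ : ∀ n → n / 2 ≡ ⌊ n /2⌋
n/2≡⌊n/2⌋ 0             = refl
n/2≡⌊n/2⌋ 1             = refl
n/2≡⌊n/2⌋ (suc (suc n)) = trans (m/n≡1+[m∸n]/n (s≤s (s≤s (z≤n {n})))) (cong suc (n/2≡⌊n/2⌋ n))

⌈n/2⌉≤1+⌊n/2⌋ : ∀ n → ⌈ n /2⌉ ≤ suc ⌊ n /2⌋
⌈n/2⌉≤1+⌊n/2⌋ 0             = z≤n
⌈n/2⌉≤1+⌊n/2⌋ 1             = ≤-refl
⌈n/2⌉≤1+⌊n/2⌋ (suc (suc n)) = s≤s (⌈n/2⌉≤1+⌊n/2⌋ n)

halving-induction : ∀ {ℓ} (P : ℕ → Set ℓ) → P 1 →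
  (∀ n → 2 ≤ n → P ⌊ n /2⌋ → P ⌈ n /2⌉ → P n) → ∀ n → 1 ≤ n → P n
halving-induction P base step = <-rec (λ n → 1 ≤ n → P n) go
  where
  go : ∀ n → (∀ {m} → m < n → 1 ≤ m → P m) → 1 ≤ n → P n
  go 1               _   _ = base
  go n@(suc (suc m)) rec _ =
    step n (s≤s (s≤s z≤n)) (rec (⌊n/2⌋<n (suc m)) (s≤s z≤n)) (rec (⌈n/2⌉<n m) (s≤s z≤n))

module _ {A : Set} (p : A → Bool) where

  countᵇ-++ : ∀ {m n} (xs : Vec A m) (ys : Vec A n) → countᵇ p (xs ++ ys) ≡ countᵇ p xs + countᵇ p ys
  countᵇ-++ []       ys = refl
  countᵇ-++ (x ∷ xs) ys with p x
  ... | true  = cong suc (countᵇ-++ xs ys)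
  ... | false = countᵇ-++ xs ys

  countᵇ-map : ∀ {B : Set} {q : B → Bool} (f : B → A) → (∀ x → p (f x) ≡ q x) →
    ∀ {n} (xs : Vec B n) → countᵇ p (Vec.map f xs) ≡ countᵇ q xs
  countᵇ-map f pf []       = refl
  countᵇ-map {q = q} f pf (x ∷ xs) rewrite pf x = cong (if q x then suc else id) (countᵇ-map f pf xs)

  countᵇ-replicate : ∀ n x → countᵇ p (replicate n x) ≡ (if p x then n else 0)
  countᵇ-replicate zero    x with p x
  ... | true  = refl
  ... | false = refl
  countᵇ-replicate (suc n) x with p x in px
  ... | true  = cong suc (trans (countᵇ-replicate n x) (cong (if_then n else 0) px))
  ... | false = trans (countᵇ-replicate n x) (cong (if_then n else 0) px)

  countᵇ-none : (∀ x → p x ≡ false) → ∀ {n} (xs : Vec A n) → countᵇ p xs ≡ 0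
  countᵇ-none none []       = refl
  countᵇ-none none (x ∷ xs) rewrite none x = countᵇ-none none xs

  countᵇ-removeAt : ∀ {n} (xs : Vec A (suc n)) i → p (lookup xs i) ≡ true →
    countᵇ p xs ≡ suc (countᵇ p (removeAt xs i))
  countᵇ-removeAt (x ∷ xs)     zero    px rewrite px = refl
  countᵇ-removeAt (x ∷ y ∷ xs) (suc i) pxi with p x
  ... | true  = cong suc (countᵇ-removeAt (y ∷ xs) i pxi)
  ... | false = countᵇ-removeAt (y ∷ xs) i pxi

  injective⇒≤countᵇ : ∀ {m n} (xs : Vec A m) {f : Fin n → Fin m} → Injective _≡_ _≡_ f →
    (∀ j → p (lookup xs (f j)) ≡ true) → n ≤ countᵇ p xs
  injective⇒≤countᵇ {n = zero}  xs           _     _   = z≤n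
  injective⇒≤countᵇ {n = suc _} []         {f} _     _   = contradiction (f zero) λ ()
  injective⇒≤countᵇ {n = suc n} xs@(_ ∷ _) {f} f-inj all rewrite countᵇ-removeAt xs (f zero) (all zero) =
    s≤s (injective⇒≤countᵇ (removeAt xs (f zero)) {f′} f′-inj all′)
    where
    f0≢f[1+j] : ∀ j → f zero ≢ f (suc j)
    f0≢f[1+j] j eq = contradiction (f-inj eq) λ ()
    f′ : Fin n → Fin _
    f′ j = punchOut (f0≢f[1+j] j)
    f′-inj : Injective _≡_ _≡_ f′
    f′-inj eq = suc-injective (f-inj (punchOut-injective (f0≢f[1+j] _) (f0≢f[1+j] _) eq))
    all′ : ∀ j → p (lookup (removeAt xs (f zero)) (f′ j)) ≡ true
    all′ j = trans (cong p (removeAt-punchOut xs (f0≢f[1+j] j))) (all (suc j))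

ChoiceProperty-mono : ∀ {n m m′} → m ≤ m′ → ChoiceProperty n m → ChoiceProperty n m′
ChoiceProperty-mono {m = m} {m′} m≤m′ choice X pairs incompatible =
  let (A , f , f-injective , f-chooses) = choice X (pairs ∘ embed) (incompatible ∘ embed)
  in A , embed ∘ f , f-injective ∘ inject≤-injective m≤m′ m≤m′ _ _ , f-chooses
  where
  embed : Fin m → Fin m′
  embed i = inject≤ i m≤m′

∈⇒≤sum : ∀ {n ns} → n ∈ ns → n ≤ sum ns
∈⇒≤sum (here refl)  = m≤m+n _ _
∈⇒≤sum (there n∈ns) = ≤-trans (∈⇒≤sum n∈ns) (m≤n+m _ _)

module _ {P : Set} where

  FiniteColumn : Subset (ℕ × P) → P → Set
  FiniteColumn A q = ∃ λ b → ∀ x → b ≤ x → A (x , q) ≡ false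

  finiteColumn-⊆list : (xs : List (ℕ × P)) (A : Subset (ℕ × P)) →
    (∀ y → A y ≡ true → y ∈ xs) → ∀ q → FiniteColumn A q
  finiteColumn-⊆list xs A A⊆xs q = suc (sum (map proj₁ xs)) , beyond
    where
    beyond : ∀ x → suc (sum (map proj₁ xs)) ≤ x → A (x , q) ≡ false
    beyond x bound≤x with A (x , q) in Axq
    ... | false = refl
    ... | true  = ⊥-elim (≤⇒≯ (∈⇒≤sum (∈-map⁺ proj₁ (A⊆xs (x , q) Axq))) bound≤x)

  finiteColumn-∪ : ∀ {A B q} → FiniteColumn A q → FiniteColumn B q → FiniteColumn (λ y → A y ∨ B y) q
  finiteColumn-∪ (b₁ , A-beyond) (b₂ , B-beyond) = b₁ ⊔ b₂ , λ x b≤x →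
    cong₂ _∨_ (A-beyond x (≤-trans (m≤m⊔n b₁ b₂) b≤x)) (B-beyond x (≤-trans (m≤n⊔m b₁ b₂) b≤x))

  finiteColumn-⊆ : ∀ {A B q} → (∀ y → B y ≡ true → A y ≡ true) → FiniteColumn A q → FiniteColumn B q
  finiteColumn-⊆ {A} {B} {q} B⊆A (b , A-beyond) = b , B-beyond
    where
    B-beyond : ∀ x → b ≤ x → B (x , q) ≡ false
    B-beyond x b≤x with B (x , q) in Bxq
    ... | false = refl
    ... | true  = trans (sym (B⊆A (x , q) Bxq)) (A-beyond x b≤x)

  finiteColumns : (P → Bool) → Ideal (ℕ × P)
  finiteColumns S = record
    { mem    = λ A → ∀ q → S q ≡ true → FiniteColumn A q
    ; finite = λ xs A A⊆xs q _ → finiteColumn-⊆list xs A A⊆xs q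
    ; union  = λ A B A∈ B∈ q Sq → finiteColumn-∪ {A} {B} (A∈ q Sq) (B∈ q Sq)
    ; down   = λ _ _ B⊆A A∈ q Sq → finiteColumn-⊆ B⊆A (A∈ q Sq)
    }

  finiteColumns-proper : ∀ {S q} → S q ≡ true → Proper (finiteColumns S)
  finiteColumns-proper {q = q} Sq X∈ = let (b , beyond) = X∈ q Sq in contradiction (beyond b ≤-refl) λ ()

record DisjointPair (P : Set) : Set where
  field
    left right     : P → Bool
    left-nonempty  : ∃ λ q → left q ≡ true
    right-nonempty : ∃ λ q → right q ≡ true
    disjoint       : ∀ q → left q ≡ true → right q ≡ false
open DisjointPair

module _ {P : Set} where

  toProperPair : DisjointPair P → ProperPair (ℕ × P)
  toProperPair p = record
    { fst       = finiteColumns (left p)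
    ; snd       = finiteColumns (right p)
    ; fstProper = finiteColumns-proper (proj₂ (left-nonempty p))
    ; sndProper = finiteColumns-proper (proj₂ (right-nonempty p))
    }

  toProperPair-incompatible : ∀ p → Incompatible (toProperPair p)
  toProperPair-incompatible p =
    (λ y → right p (proj₂ y)) ,
    (λ q Lq → 0 , λ _ _ → disjoint p q Lq) ,
    (λ q Rq → 0 , λ _ _ → cong not Rq)

Bool-pair : DisjointPair Bool
Bool-pair = record
  { left = id ; right = not
  ; left-nonempty = true , refl ; right-nonempty = false , refl
  ; disjoint = λ { true _ → refl }
  }

module _ {A B : Set} where

  ⊎-pair : A → B → DisjointPair (A ⊎ B)
  ⊎-pair a b = record
    { left = [ const true , const false ]′ ; right = [ const false , const true ]′
    ; left-nonempty = inj₁ a , refl ; right-nonempty = inj₂ b , refl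
    ; disjoint = λ { (inj₁ _) _ → refl ; (inj₂ _) () }
    }

  inj₁-pair : DisjointPair A → DisjointPair (A ⊎ B)
  inj₁-pair p = record
    { left = [ left p , const false ]′ ; right = [ right p , const false ]′
    ; left-nonempty = inj₁ (proj₁ (left-nonempty p)) , proj₂ (left-nonempty p)
    ; right-nonempty = inj₁ (proj₁ (right-nonempty p)) , proj₂ (right-nonempty p)
    ; disjoint = λ { (inj₁ q) → disjoint p q ; (inj₂ _) () }
    }

  inj₂-pair : DisjointPair B → DisjointPair (A ⊎ B)
  inj₂-pair p = record
    { left = [ const false , left p ]′ ; right = [ const false , right p ]′
    ; left-nonempty = inj₂ (proj₁ (left-nonempty p)) , proj₂ (left-nonempty p)
    ; right-nonempty = inj₂ (proj₁ (right-nonempty p)) , proj₂ (right-nonempty p)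
    ; disjoint = λ { (inj₁ _) () ; (inj₂ q) → disjoint p q }
    }

-- In node a l r, the label a is the number of copies of the pair separating the points of
-- l from those of r.
data Tree : Set where
  leaf : Tree
  node : ℕ → Tree → Tree → Tree

Point : Tree → Set
Point leaf         = Bool
Point (node _ l r) = Point l ⊎ Point r

somePoint : ∀ t → Point t
somePoint leaf         = true
somePoint (node _ l _) = inj₁ (somePoint l)

size : Tree → ℕ
size leaf         = 1
size (node a l r) = a + (size l + size r)

pairs : ∀ t → Vec (DisjointPair (Point t)) (size t)
pairs leaf         = Bool-pair ∷ []
pairs (node a l r) =
  replicate a (⊎-pair (somePoint l) (somePoint r)) ++ (Vec.map inj₁-pair (pairs l) ++ Vec.map inj₂-pair (pairs r))

anyᵇ : ∀ t → (Point t → Bool) → Bool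
anyᵇ leaf         F = F true ∨ F false
anyᵇ (node _ l r) F = anyᵇ l (F ∘ inj₁) ∨ anyᵇ r (F ∘ inj₂)

anyᵇ-false : ∀ t → anyᵇ t (const false) ≡ false
anyᵇ-false leaf         = refl
anyᵇ-false (node _ l r) rewrite anyᵇ-false l | anyᵇ-false r = refl

anyᵇ-sound : ∀ t {F} → anyᵇ t F ≡ true → ∃ λ q → F q ≡ true
anyᵇ-sound leaf {F} any with F true in Ftrue
... | true  = true , Ftrue
... | false = false , any
anyᵇ-sound (node _ l r) {F} any with anyᵇ l (F ∘ inj₁) in anyˡ
... | true  = let (q , Fq) = anyᵇ-sound l anyˡ in inj₁ q , Fq
... | false = let (q , Fq) = anyᵇ-sound r any  in inj₂ q , Fq

anyᵇ-complete : ∀ t {F} q → F q ≡ true → anyᵇ t F ≡ true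
anyᵇ-complete leaf {F} true  Fq rewrite Fq = refl
anyᵇ-complete leaf {F} false Fq rewrite Fq = ∨-zeroʳ (F true)
anyᵇ-complete (node _ l r) {F} (inj₁ q) Fq = cong (_∨ _) (anyᵇ-complete l {F ∘ inj₁} q Fq)
anyᵇ-complete (node _ l r) {F} (inj₂ q) Fq =
  trans (cong (_ ∨_) (anyᵇ-complete r {F ∘ inj₂} q Fq)) (∨-zeroʳ _)

meets : ∀ t → (S T : Point t → Bool) → Bool
meets t S T = anyᵇ t (λ q → S q ∧ T q)

splits : ∀ t → (Point t → Bool) → DisjointPair (Point t) → Bool
splits t T p = meets t (left p) T xor meets t (right p) T

module _ {a l r} (T : Point (node a l r) → Bool) where

  private
    ∨-nothing-rightʳ : ∀ x → x ∨ anyᵇ r (const false) ≡ x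
    ∨-nothing-rightʳ x = trans (cong (x ∨_) (anyᵇ-false r)) (∨-identityʳ x)

    nothing-left-∨ : ∀ x → anyᵇ l (const false) ∨ x ≡ x
    nothing-left-∨ x = cong (_∨ x) (anyᵇ-false l)

  splits-inj₁ : ∀ p → splits (node a l r) T (inj₁-pair p) ≡ splits l (T ∘ inj₁) p
  splits-inj₁ p = cong₂ _xor_
    (∨-nothing-rightʳ (meets l (left p) (T ∘ inj₁))) (∨-nothing-rightʳ (meets l (right p) (T ∘ inj₁)))

  splits-inj₂ : ∀ p → splits (node a l r) T (inj₂-pair p) ≡ splits r (T ∘ inj₂) p
  splits-inj₂ p = cong₂ _xor_ (nothing-left-∨ _) (nothing-left-∨ _)

  splits-⊎ : ∀ x y → splits (node a l r) T (⊎-pair x y) ≡ anyᵇ l (T ∘ inj₁) xor anyᵇ r (T ∘ inj₂)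
  splits-⊎ _ _ = cong₂ _xor_ (∨-nothing-rightʳ (anyᵇ l (T ∘ inj₁))) (nothing-left-∨ (anyᵇ r (T ∘ inj₂)))

splits-miss : ∀ {t T} → anyᵇ t T ≡ false → ∀ p → splits t T p ≡ false
splits-miss {t} {T} miss p = cong₂ _xor_ (meets-miss (left p)) (meets-miss (right p))
  where
  meets-miss : ∀ S → meets t S T ≡ false
  meets-miss S with meets t S T in meet
  ... | false = refl
  ... | true  = let (q , SqTq) = anyᵇ-sound t meet in
                trans (sym (anyᵇ-complete t q (∧-conicalʳ (S q) (T q) SqTq))) miss

SplitBound : Tree → ℕ → Set
SplitBound t N = ∀ T → countᵇ (splits t T) (pairs t) ≤ N

splitBound-leaf : SplitBound leaf 1
splitBound-leaf T = count≤n (T? ∘ splits leaf T) (pairs leaf)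

countᵇ-splits-miss : ∀ t {T} → anyᵇ t T ≡ false → countᵇ (splits t T) (pairs t) ≡ 0
countᵇ-splits-miss t {T} miss = countᵇ-none (splits t T) (splits-miss miss) (pairs t)

countᵇ-splits-node : ∀ a l r T → countᵇ (splits (node a l r) T) (pairs (node a l r)) ≡
  (if anyᵇ l (T ∘ inj₁) xor anyᵇ r (T ∘ inj₂) then a else 0) +
  (countᵇ (splits l (T ∘ inj₁)) (pairs l) + countᵇ (splits r (T ∘ inj₂)) (pairs r))
countᵇ-splits-node a l r T = begin
  countᵇ s (replicate a link ++ (Vec.map inj₁-pair (pairs l) ++ Vec.map inj₂-pair (pairs r)))
    ≡⟨ countᵇ-++ s (replicate a link) _ ⟩
  countᵇ s (replicate a link) + countᵇ s (Vec.map inj₁-pair (pairs l) ++ Vec.map inj₂-pair (pairs r))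
    ≡⟨ cong₂ _+_ (countᵇ-replicate s a link) (countᵇ-++ s (Vec.map inj₁-pair (pairs l)) _) ⟩
  (if s link then a else 0) + (countᵇ s (Vec.map inj₁-pair (pairs l)) + countᵇ s (Vec.map inj₂-pair (pairs r)))
    ≡⟨ cong₂ _+_ (cong (if_then a else 0) (splits-⊎ {a} {l} {r} T (somePoint l) (somePoint r)))
                 (cong₂ _+_ (countᵇ-map s inj₁-pair (splits-inj₁ {a} {l} {r} T) (pairs l))
                            (countᵇ-map s inj₂-pair (splits-inj₂ {a} {l} {r} T) (pairs r))) ⟩
  (if anyᵇ l (T ∘ inj₁) xor anyᵇ r (T ∘ inj₂) then a else 0) +
  (countᵇ (splits l (T ∘ inj₁)) (pairs l) + countᵇ (splits r (T ∘ inj₂)) (pairs r)) ∎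
  where
  open ≡-Reasoning
  s = splits (node a l r) T
  link = ⊎-pair (somePoint l) (somePoint r)

splitBound-node : ∀ {a l r p q} → a ≤ p → a ≤ q →
  SplitBound l p → SplitBound r q → SplitBound (node a l r) (p + q)
splitBound-node {a} {l} {r} {p} {q} a≤p a≤q boundˡ boundʳ T =
  ≤-trans (≤-reflexive (countᵇ-splits-node a l r T)) (by-hits _ _ refl refl)
  where
  open ≤-Reasoning
  Tˡ = T ∘ inj₁
  Tʳ = T ∘ inj₂
  cˡ = countᵇ (splits l Tˡ) (pairs l)
  cʳ = countᵇ (splits r Tʳ) (pairs r)
  by-hits : ∀ hˡ hʳ → anyᵇ l Tˡ ≡ hˡ → anyᵇ r Tʳ ≡ hʳ →
    (if hˡ xor hʳ then a else 0) + (cˡ + cʳ) ≤ p + q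
  by-hits true  true  _     _     = +-mono-≤ (boundˡ Tˡ) (boundʳ Tʳ)
  by-hits true  false _     missʳ = begin
    a + (cˡ + cʳ)  ≡⟨ cong (λ c → a + (cˡ + c)) (countᵇ-splits-miss r missʳ) ⟩
    a + (cˡ + 0)   ≡⟨ cong (a +_) (+-identityʳ cˡ) ⟩
    a + cˡ         ≤⟨ +-mono-≤ a≤q (boundˡ Tˡ) ⟩
    q + p          ≡⟨ +-comm q p ⟩
    p + q          ∎
  by-hits false true  missˡ _     = begin
    a + (cˡ + cʳ)  ≡⟨ cong (λ c → a + (c + cʳ)) (countᵇ-splits-miss l missˡ) ⟩
    a + cʳ         ≤⟨ +-mono-≤ a≤p (boundʳ Tʳ) ⟩
    p + q          ∎
  by-hits false false missˡ missʳ = begin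
    cˡ + cʳ        ≡⟨ cong₂ _+_ (countᵇ-splits-miss l missˡ) (countᵇ-splits-miss r missʳ) ⟩
    0              ≤⟨ z≤n ⟩
    p + q          ∎

module _ {t : Tree} (A : Subset (ℕ × Point t)) (finite? : ∀ q → Dec (FiniteColumn A q)) where

  infiniteColumns : Point t → Bool
  infiniteColumns q = isNo (finite? q)

  private
    infinite⇒¬finite : ∀ q → infiniteColumns q ≡ true → ¬ FiniteColumn A q
    infinite⇒¬finite q with finite? q
    ... | yes _    = λ ()
    ... | no ¬fin  = λ _ → ¬fin

    ¬infinite⇒finite : ∀ q → infiniteColumns q ≡ false → FiniteColumn A q
    ¬infinite⇒finite q with finite? q
    ... | yes fin = λ _ → fin
    ... | no _    = λ ()

  ∈⇒¬meets-infinite : ∀ S → mem (finiteColumns S) A → meets t S infiniteColumns ≡ false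
  ∈⇒¬meets-infinite S A∈ with meets t S infiniteColumns in meet
  ... | false = refl
  ... | true  = let (q , Sq∧Tq) = anyᵇ-sound t meet in
    contradiction (A∈ q (∧-conicalˡ _ _ Sq∧Tq)) (infinite⇒¬finite q (∧-conicalʳ _ _ Sq∧Tq))

  ∉⇒meets-infinite : ∀ S → ¬ mem (finiteColumns S) A → meets t S infiniteColumns ≡ true
  ∉⇒meets-infinite S A∉ with meets t S infiniteColumns in meet
  ... | true  = refl
  ... | false = contradiction (λ q Sq → ¬infinite⇒finite q (missed q Sq)) A∉
    where
    missed : ∀ q → S q ≡ true → infiniteColumns q ≡ false
    missed q Sq with infiniteColumns q in Tq
    ... | false = refl
    ... | true  = trans (sym (anyᵇ-complete t {λ q → S q ∧ infiniteColumns q} q (cong₂ _∧_ Sq Tq))) meet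

  chooses⇒splits : ∀ p → Chooses A (toProperPair p) → splits t infiniteColumns p ≡ true
  chooses⇒splits p (inj₁ (A∈ˡ , A∉ʳ)) =
    cong₂ _xor_ (∈⇒¬meets-infinite (left p) A∈ˡ) (∉⇒meets-infinite (right p) A∉ʳ)
  chooses⇒splits p (inj₂ (A∈ʳ , A∉ˡ)) =
    cong₂ _xor_ (∉⇒meets-infinite (left p) A∉ˡ) (∈⇒¬meets-infinite (right p) A∈ʳ)

¬¬-decidable : ∀ t (F : Point t → Set) → ¬ ¬ (∀ q → Dec (F q))
¬¬-decidable leaf         F k =
  ¬¬-excluded-middle λ Ftrue? → ¬¬-excluded-middle λ Ffalse? → k λ { true → Ftrue? ; false → Ffalse? }
¬¬-decidable (node _ l r) F k =
  ¬¬-decidable l (F ∘ inj₁) λ Fˡ? → ¬¬-decidable r (F ∘ inj₂) λ Fʳ? → k [ Fˡ? , Fʳ? ]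

-- Finiteness of a column is undecidable, but the goal is ⊥, so we may assume it decided at
-- each of the finitely many points.
splitBound⇒¬choice : ∀ {t N} → SplitBound t N → ¬ ChoiceProperty (suc N) (size t)
splitBound⇒¬choice {t} {N} bound choice with
  choice (ℕ × Point t) (toProperPair ∘ lookup (pairs t)) (toProperPair-incompatible ∘ lookup (pairs t))
... | A , f , f-injective , f-chooses = ¬¬-decidable t (FiniteColumn A) λ finite? →
  let T = infiniteColumns A finite? in
  1+n≰n (≤-trans (injective⇒≤countᵇ (splits t T) (pairs t) f-injective
                    (λ j → chooses⇒splits A finite? (lookup (pairs t) (f j)) (f-chooses j)))
                 (bound T))

module _ (k : ℕ → ℕ) (k1≡1 : k 1 ≡ 1) (k-rec : ∀ n → 2 ≤ n → k n ≡ n / 2 + k (n / 2) + k ((n + 1) / 2)) where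

  k-halving : ∀ n → 2 ≤ n → k n ≡ ⌊ n /2⌋ + k ⌊ n /2⌋ + k ⌈ n /2⌉
  k-halving n 2≤n = trans (k-rec n 2≤n) (cong₂ (λ a b → a + k a + k b) (n/2≡⌊n/2⌋ n) [n+1]/2≡⌈n/2⌉)
    where
    [n+1]/2≡⌈n/2⌉ : (n + 1) / 2 ≡ ⌈ n /2⌉
    [n+1]/2≡⌈n/2⌉ = trans (cong (_/ 2) (+-comm n 1)) (n/2≡⌊n/2⌋ (suc n))

  halvingTree : ∀ N → 1 ≤ N → Σ Tree λ t → size t ≡ k N × SplitBound t N
  halvingTree = halving-induction _ (leaf , sym k1≡1 , splitBound-leaf) λ where
    n 2≤n (l , size-l , bound-l) (r , size-r , bound-r) →
      node ⌊ n /2⌋ l r ,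
      trans (cong (⌊ n /2⌋ +_) (cong₂ _+_ size-l size-r))
            (trans (sym (+-assoc ⌊ n /2⌋ _ _)) (sym (k-halving n 2≤n))) ,
      subst (SplitBound (node ⌊ n /2⌋ l r)) (⌊n/2⌋+⌈n/2⌉≡n n)
            (splitBound-node {⌊ n /2⌋} ≤-refl (⌊n/2⌋≤⌈n/2⌉ n) bound-l bound-r)

  ¬ChoiceProperty-k : ∀ N → 1 ≤ N → ¬ ChoiceProperty (suc N) (k N)
  ¬ChoiceProperty-k N 1≤N with halvingTree N 1≤N
  ... | t , size-t , bound rewrite sym size-t = splitBound⇒¬choice bound

  ChoiceProperty⇒k[n∸1]<m : (n : ℕ) → 1 < n → (m : ℕ) → ChoiceProperty n m → k (n ∸ 1) + 1 ≤ m
  ChoiceProperty⇒k[n∸1]<m (suc N) (s≤s 1≤N) m choice with m ≤? k N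
  ... | yes m≤k = contradiction (ChoiceProperty-mono m≤k choice) (¬ChoiceProperty-k N 1≤N)
  ... | no  m≰k = subst (_≤ m) (+-comm 1 (k N)) (≰⇒> m≰k)

  k-power-bound : (n : ℕ) → 1 ≤ n → 2 * n ^ n < 2 ^ (2 * k n + n)
  k-power-bound = halving-induction _ base λ n 2≤n bound-⌊n/2⌋ bound-⌈n/2⌉ →
    subst₂ (λ m kn → 2 * m ^ m < 2 ^ (2 * kn + m)) (⌊n/2⌋+⌈n/2⌉≡n n) (sym (k-halving n 2≤n))
      (power-bound-step (⌊n/2⌋≤⌈n/2⌉ n) (⌈n/2⌉≤1+⌊n/2⌋ n) bound-⌊n/2⌋ bound-⌈n/2⌉)
    where
    base : 2 * 1 ^ 1 < 2 ^ (2 * k 1 + 1)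
    base rewrite k1≡1 = s≤s (s≤s (s≤s z≤n))

  ChoiceProperty⇒power-bound : (n : ℕ) → 1 < n → (m : ℕ) → ChoiceProperty n m →
    16 * (n ∸ 1) ^ (n ∸ 1) < 2 ^ (2 * m + n)
  ChoiceProperty⇒power-bound (suc N) 1<n@(s≤s 1≤N) m choice = begin-strict
    16 * N ^ N                        ≡⟨ *-assoc 8 2 (N ^ N) ⟩
    8 * (2 * N ^ N)                   <⟨ *-monoʳ-< 8 (k-power-bound N 1≤N) ⟩
    8 * 2 ^ (2 * k N + N)             ≡⟨ ^-distribˡ-+-* 2 3 (2 * k N + N) ⟨
    2 ^ (3 + (2 * k N + N))           ≡⟨ cong (2 ^_) (exponent (k N) N) ⟩
    2 ^ (2 * (k N + 1) + suc N)       ≤⟨ ^-monoʳ-≤ 2 (+-monoˡ-≤ (suc N) (*-monoʳ-≤ 2 k[N]<m)) ⟩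
    2 ^ (2 * m + suc N)               ∎
    where
    open ≤-Reasoning
    k[N]<m : k N + 1 ≤ m
    k[N]<m = ChoiceProperty⇒k[n∸1]<m (suc N) 1<n m choice
    exponent : ∀ κ N → 3 + (2 * κ + N) ≡ 2 * (κ + 1) + suc N
    exponent = solve-∀

mainTheorem10 : (k : ℕ → ℕ) → k 1 ≡ 1 →
    (∀ n → 2 ≤ n → k n ≡ n / 2 + k (n / 2) + k ((n + 1) / 2)) →
    ((n : ℕ) → 1 < n → (m : ℕ) → ChoiceProperty n m → k (n ∸ 1) + 1 ≤ m)
    × ((n : ℕ) → 1 ≤ n → 2 * n ^ n < 2 ^ (2 * k n + n))
    × ((n : ℕ) → 1 < n → (m : ℕ) → ChoiceProperty n m → 16 * (n ∸ 1) ^ (n ∸ 1) < 2 ^ (2 * m + n))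
mainTheorem10 k k1≡1 k-rec =
  ChoiceProperty⇒k[n∸1]<m k k1≡1 k-rec , k-power-bound k k1≡1 k-rec , ChoiceProperty⇒power-bound k k1≡1 k-rec
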